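{- Let $q,q''$ be integral nonsingular ternary quadratic forms with matrices $Q,Q''$, and let $A=(a_{ij})\in R(q,q'')$, i.e. $A\in\mathbb Z^3_3$ with ${}^tAQA=Q''$. Let $\varphi_A:C(\mathbb Z^3,q'')\to C(\mathbb Z^3,q)$ be the algebra homomorphism with $\varphi_A(e''_j)=\sum_{i}a_{ij}e_i$ for $j=1,2,3$. Then $\varphi_A(t'')=(\det A)\cdot t$.
   Context: For an integral ternary form $q$ on $E=\mathbb Z^3$ with standard basis $e_1,e_2,e_3$, the Clifford algebra $C(E,q)$ is the $\mathbb Z$-algebra generated by $E$ subject to $x^2=q(x)\cdot1$ for $x\in E$; $x\mapsto\bar x$ is its antiautomorphism with $\bar e_j=-e_j$. The special element is $t=e_1e_2e_3+\overline{e_1e_2e_3}\in C(E,q)$; $t''$ is the analogous element of $C(\mathbb Z^3,q'')$ built from its standard basis $e''_1,e''_2,e''_3$. $\varphi_A$ exists by the universal property since $x\mapsto Ax$ is an isometry $(\mathbb Z^3,q'')\to(\mathbb Z^3,q)$. -}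

module Defs where

open import Data.Fin using (Fin; zero; suc)
open import Data.Integer using (ℤ; _+_; _*_; -_; +_)
open import Relation.Binary.PropositionalEquality using (_≡_)

Vec3 : Set
Vec3 = Fin 3 → ℤ

Mat3 : Set
Mat3 = Fin 3 → Fin 3 → ℤ

i1 i2 i3 : Fin 3
i1 = zero
i2 = suc zero
i3 = suc (suc zero)

sum3 : (Fin 3 → ℤ) → ℤ
sum3 f = f i1 + f i2 + f i3

_·ᴹ_ : Mat3 → Mat3 → Mat3
(A ·ᴹ B) i j = sum3 (λ k → A i k * B k j)

ᵗ_ : Mat3 → Mat3
(ᵗ A) i j = A j i

det3 : Mat3 → ℤ
det3 A =
    A i1 i1 * (A i2 i2 * A i3 i3 + - (A i2 i3 * A i3 i2))
  + - (A i1 i2 * (A i2 i1 * A i3 i3 + - (A i2 i3 * A i3 i1)))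
  + A i1 i3 * (A i2 i1 * A i3 i2 + - (A i2 i2 * A i3 i1))

record Form : Set where
  field
    a11 a22 a33 a12 a13 a23 : ℤ

open Form public

ev : Form → Vec3 → ℤ
ev q x = a11 q * (x i1 * x i1) + a22 q * (x i2 * x i2) + a33 q * (x i3 * x i3)
       + a12 q * (x i1 * x i2) + a13 q * (x i1 * x i3) + a23 q * (x i2 * x i3)

-- Matrix of q: Gram matrix of the bilinear form b(x,y) = q(x+y) - q(x) - q(y),
-- so q(x) = ½ ᵗx Q x.
matQ : Form → Mat3
matQ q zero zero = (+ 2) * a11 q
matQ q zero (suc zero) = a12 q
matQ q zero (suc (suc zero)) = a13 q
matQ q (suc zero) zero = a12 q
matQ q (suc zero) (suc zero) = (+ 2) * a22 q
matQ q (suc zero) (suc (suc zero)) = a23 q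
matQ q (suc (suc zero)) zero = a13 q
matQ q (suc (suc zero)) (suc zero) = a23 q
matQ q (suc (suc zero)) (suc (suc zero)) = (+ 2) * a33 q

Nonsingular : Form → Set
Nonsingular q = det3 (matQ q) ≡ + 0 → Data.Empty.⊥
  where import Data.Empty

InR : Form → Form → Mat3 → Set
InR q q'' A = ∀ i j → ((ᵗ A) ·ᴹ (matQ q ·ᴹ A)) i j ≡ matQ q'' i j

-- The Clifford algebra C(ℤ³,q), by its presentation: the free
-- (noncommutative, associative, unital) ℤ-algebra on e1,e2,e3, modulo the
-- two-sided ideal generated by x² - q(x)·1 for x ∈ E.  Elements are terms;
-- equality in C(E,q) is the congruence _≈⟨_⟩_ below.

infixl 6 _⊕_
infixl 7 _⊗_

data CTerm : Set where
  gen   : Fin 3 → CTerm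
  const : ℤ → CTerm
  _⊕_   : CTerm → CTerm → CTerm
  _⊗_   : CTerm → CTerm → CTerm

neg : CTerm → CTerm
neg a = const (- (+ 1)) ⊗ a

vec : Vec3 → CTerm
vec x = const (x i1) ⊗ gen i1 ⊕ const (x i2) ⊗ gen i2 ⊕ const (x i3) ⊗ gen i3

data Cl≈ (q : Form) : CTerm → CTerm → Set where
  refl≈  : ∀ {a} → Cl≈ q a a
  sym≈   : ∀ {a b} → Cl≈ q a b → Cl≈ q b a
  trans≈ : ∀ {a b c} → Cl≈ q a b → Cl≈ q b c → Cl≈ q a c
  ⊕-cong : ∀ {a a' b b'} → Cl≈ q a a' → Cl≈ q b b' → Cl≈ q (a ⊕ b) (a' ⊕ b')
  ⊗-cong : ∀ {a a' b b'} → Cl≈ q a a' → Cl≈ q b b' → Cl≈ q (a ⊗ b) (a' ⊗ b')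
  ⊕-assoc : ∀ a b c → Cl≈ q ((a ⊕ b) ⊕ c) (a ⊕ (b ⊕ c))
  ⊕-comm  : ∀ a b → Cl≈ q (a ⊕ b) (b ⊕ a)
  ⊕-idˡ   : ∀ a → Cl≈ q (const (+ 0) ⊕ a) a
  ⊕-invˡ  : ∀ a → Cl≈ q (neg a ⊕ a) (const (+ 0))
  ⊗-assoc : ∀ a b c → Cl≈ q ((a ⊗ b) ⊗ c) (a ⊗ (b ⊗ c))
  ⊗-idˡ   : ∀ a → Cl≈ q (const (+ 1) ⊗ a) a
  ⊗-idʳ   : ∀ a → Cl≈ q (a ⊗ const (+ 1)) a
  distribˡ : ∀ a b c → Cl≈ q (a ⊗ (b ⊕ c)) (a ⊗ b ⊕ a ⊗ c)
  distribʳ : ∀ a b c → Cl≈ q ((b ⊕ c) ⊗ a) (b ⊗ a ⊕ c ⊗ a)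
  const-+ : ∀ m n → Cl≈ q (const (m + n)) (const m ⊕ const n)
  const-* : ∀ m n → Cl≈ q (const (m * n)) (const m ⊗ const n)
  const-central : ∀ n a → Cl≈ q (const n ⊗ a) (a ⊗ const n)
  clifford : ∀ (x : Vec3) → Cl≈ q (vec x ⊗ vec x) (const (ev q x))

bar : CTerm → CTerm
bar (gen i) = neg (gen i)
bar (const n) = const n
bar (a ⊕ b) = bar a ⊕ bar b
bar (a ⊗ b) = bar b ⊗ bar a

e123 : CTerm
e123 = gen i1 ⊗ gen i2 ⊗ gen i3

tElt : CTerm
tElt = e123 ⊕ bar e123

φ : Mat3 → CTerm → CTerm
φ A (gen j) = vec (λ i → A i j)
φ A (const n) = const n
φ A (a ⊕ b) = φ A a ⊕ φ A b
φ A (a ⊗ b) = φ A a ⊗ φ A b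

-- Put τ a b c = abc + conj(abc) = abc − cba for vectors a, b, c (conj negates
-- vectors).  Since φ_A sends vectors to vectors, φ_A t'' = τ(Ae₁, Ae₂, Ae₃),
-- and t = τ(e₁, e₂, e₃).  The map τ is trilinear, and on vectors it is
-- alternating: a² and ab + ba are scalars, hence central, so
-- τ(a, a, c) = a²c − ca² = 0, τ(a, b, b) = 0, τ(a, b, a) = 0 and swapping
-- two adjacent arguments changes the sign.  An alternating trilinear map
-- on ℤ³ is det times its value on the standard basis.
module Submission where

open import Defs
open import Algebra.Bundles using (Ring)
open import Data.Fin using (Fin; zero; suc; combine)
open import Data.Integer using (ℤ; +_; -_) renaming (_+_ to _+ℤ_; _*_ to _*ℤ_)
import Data.Integer.Properties as ℤ
open import Data.Integer.Solver using (module +-*-Solver)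
open import Data.Product using (_,_)
open import Data.Vec using (Vec; _∷_; []; lookup)
open import Level using (0ℓ)
open import Relation.Binary.PropositionalEquality as ≡ using (_≡_)

pattern ₁ = zero
pattern ₂ = suc zero
pattern ₃ = suc (suc zero)

cliffordRing : Form → Ring 0ℓ 0ℓ
cliffordRing q = record
  { Carrier = CTerm
  ; _≈_ = Cl≈ q
  ; _+_ = _⊕_
  ; _*_ = _⊗_
  ; -_ = neg
  ; 0# = const (+ 0)
  ; 1# = const (+ 1)
  ; isRing = record
    { +-isAbelianGroup = record
      { isGroup = record
        { isMonoid = record
          { isSemigroup = record
            { isMagma = record
              { isEquivalence = record { refl = refl≈ ; sym = sym≈ ; trans = trans≈ }
              ; ∙-cong = ⊕-cong }
            ; assoc = ⊕-assoc }
          ; identity = ⊕-idˡ , λ a → trans≈ (⊕-comm a _) (⊕-idˡ a) }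
        ; inverse = ⊕-invˡ , λ a → trans≈ (⊕-comm a _) (⊕-invˡ a)
        ; ⁻¹-cong = ⊗-cong refl≈ }
      ; comm = ⊕-comm }
    ; *-cong = ⊗-cong
    ; *-assoc = ⊗-assoc
    ; *-identity = ⊗-idˡ , ⊗-idʳ
    ; distrib = distribˡ , distribʳ }
  }

unit : Fin 3 → Vec3
unit ₁ = lookup (+ 1 ∷ + 0 ∷ + 0 ∷ [])
unit ₂ = lookup (+ 0 ∷ + 1 ∷ + 0 ∷ [])
unit ₃ = lookup (+ 0 ∷ + 0 ∷ + 1 ∷ [])

_+ᵛ_ : Vec3 → Vec3 → Vec3
(x +ᵛ y) i = x i +ℤ y i

polar : Form → Vec3 → Vec3 → ℤ
polar q x y = ev q (x +ᵛ y) +ℤ - (ev q x +ℤ ev q y)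

column : Mat3 → Fin 3 → Vec3
column A j i = A i j

ε : Fin 3 → Fin 3 → Fin 3 → ℤ
ε ₁ ₂ ₃ = + 1
ε ₂ ₃ ₁ = + 1
ε ₃ ₁ ₂ = + 1
ε ₂ ₁ ₃ = - + 1
ε ₁ ₃ ₂ = - + 1
ε ₃ ₂ ₁ = - + 1
ε _ _ _ = + 0

det-ε : Vec3 → Vec3 → Vec3 → ℤ
det-ε x y z = sum3 λ i → x i *ℤ sum3 λ j → y j *ℤ sum3 λ k → z k *ℤ ε i j k

module DeterminantExpansion where
  open +-*-Solver using (Polynomial; con; var; _:+_; _:*_; :-_; prove)

  entry : Fin 3 → Fin 3 → Polynomial 9
  entry i j = var (combine i j)

  entries : Mat3 → Vec ℤ 9
  entries A = A ₁ ₁ ∷ A ₁ ₂ ∷ A ₁ ₃ ∷ A ₂ ₁ ∷ A ₂ ₂ ∷ A ₂ ₃ ∷ A ₃ ₁ ∷ A ₃ ₂ ∷ A ₃ ₃ ∷ []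

  det3ᴾ : Polynomial 9
  det3ᴾ =
      entry ₁ ₁ :* (entry ₂ ₂ :* entry ₃ ₃ :+ :- (entry ₂ ₃ :* entry ₃ ₂))
    :+ :- (entry ₁ ₂ :* (entry ₂ ₁ :* entry ₃ ₃ :+ :- (entry ₂ ₃ :* entry ₃ ₁)))
    :+ entry ₁ ₃ :* (entry ₂ ₁ :* entry ₃ ₂ :+ :- (entry ₂ ₂ :* entry ₃ ₁))

  sum3ᴾ : (Fin 3 → Polynomial 9) → Polynomial 9
  sum3ᴾ f = f ₁ :+ f ₂ :+ f ₃

  det-εᴾ : Polynomial 9
  det-εᴾ = sum3ᴾ λ i → entry i ₁ :* sum3ᴾ λ j → entry j ₂ :* sum3ᴾ λ k → entry k ₃ :* con (ε i j k)

  det3≡det-ε : ∀ A → det3 A ≡ det-ε (column A ₁) (column A ₂) (column A ₃)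
  det3≡det-ε A = prove (entries A) det3ᴾ det-εᴾ ≡.refl

open DeterminantExpansion using (det3≡det-ε)

lc : Vec3 → (Fin 3 → CTerm) → CTerm
lc c a = const (c ₁) ⊗ a ₁ ⊕ const (c ₂) ⊗ a ₂ ⊕ const (c ₃) ⊗ a ₃

τ : CTerm → CTerm → CTerm → CTerm
τ a b c = a ⊗ b ⊗ c ⊕ neg c ⊗ (neg b ⊗ neg a)

module CliffordAlgebra (q : Form) where
  open Ring (cliffordRing q) public
    using (_≈_; 0#; refl; sym; trans; setoid; +-identityˡ; +-identityʳ; -‿cong; -‿inverseʳ
          ; zeroˡ; +-commutativeSemigroup)
  open import Algebra.Properties.Ring (cliffordRing q)
    using (-‿involutive; -‿+-comm; -‿distribˡ-*; -‿distribʳ-*; +-inverseʳ-unique; x≈y⇒x∙y⁻¹≈ε)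
  open import Algebra.Properties.CommutativeSemigroup +-commutativeSemigroup using (interchange)
  open import Relation.Binary.Reasoning.Setoid setoid

  record Linear (L : CTerm → CTerm) : Set where
    field
      cong        : ∀ {a b} → a ≈ b → L a ≈ L b
      additive    : ∀ a b → L (a ⊕ b) ≈ L a ⊕ L b
      homogeneous : ∀ n a → L (const n ⊗ a) ≈ const n ⊗ L a

  *ʳ-linear : ∀ b → Linear (λ a → a ⊗ b)
  *ʳ-linear b = record
    { cong = λ a≈a' → ⊗-cong a≈a' refl
    ; additive = λ a a' → distribʳ b a a'
    ; homogeneous = λ n a → ⊗-assoc (const n) a b
    }

  *ˡ-linear : ∀ b → Linear (λ a → b ⊗ a)
  *ˡ-linear b = record
    { cong = ⊗-cong refl
    ; additive = distribˡ b
    ; homogeneous = λ n a → begin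
        b ⊗ (const n ⊗ a) ≈⟨ ⊗-assoc b (const n) a ⟨
        (b ⊗ const n) ⊗ a ≈⟨ ⊗-cong (const-central n b) refl ⟨
        (const n ⊗ b) ⊗ a ≈⟨ ⊗-assoc (const n) b a ⟩
        const n ⊗ (b ⊗ a) ∎
    }

  ∘-linear : ∀ {L M} → Linear L → Linear M → Linear (λ a → L (M a))
  ∘-linear L M = record
    { cong = λ a≈b → L.cong (M.cong a≈b)
    ; additive = λ a b → trans (L.cong (M.additive a b)) (L.additive _ _)
    ; homogeneous = λ n a → trans (L.cong (M.homogeneous n a)) (L.homogeneous n _)
    }
    where
    module L = Linear L
    module M = Linear M

  +-linear : ∀ {L M} → Linear L → Linear M → Linear (λ a → L a ⊕ M a)
  +-linear L M = record
    { cong = λ a≈b → ⊕-cong (L.cong a≈b) (M.cong a≈b)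
    ; additive = λ a b → trans (⊕-cong (L.additive a b) (M.additive a b)) (interchange _ _ _ _)
    ; homogeneous = λ n a →
        trans (⊕-cong (L.homogeneous n a) (M.homogeneous n a)) (sym (distribˡ (const n) _ _))
    }
    where
    module L = Linear L
    module M = Linear M

  linear-lc : ∀ {L} → Linear L → ∀ c a → L (lc c a) ≈ lc c (λ i → L (a i))
  linear-lc L c a =
    trans (additive _ _) (⊕-cong (trans (additive _ _) (⊕-cong (homogeneous _ _) (homogeneous _ _)))
                                 (homogeneous _ _))
    where open Linear L

  lc-cong : ∀ c {a b} → (∀ i → a i ≈ b i) → lc c a ≈ lc c b
  lc-cong c a≈b = ⊕-cong (⊕-cong (⊗-cong refl (a≈b ₁)) (⊗-cong refl (a≈b ₂))) (⊗-cong refl (a≈b ₃))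

  scalar-+ : ∀ m n a → const (m +ℤ n) ⊗ a ≈ const m ⊗ a ⊕ const n ⊗ a
  scalar-+ m n a = trans (⊗-cong (const-+ m n) refl) (distribʳ a _ _)

  scalar-* : ∀ m n a → const m ⊗ (const n ⊗ a) ≈ const (m *ℤ n) ⊗ a
  scalar-* m n a = trans (sym (⊗-assoc _ _ _)) (⊗-cong (sym (const-* m n)) refl)

  lc-+ : ∀ c d a → lc (c +ᵛ d) a ≈ lc c a ⊕ lc d a
  lc-+ c d a = begin
    lc (c +ᵛ d) a
      ≈⟨ ⊕-cong (⊕-cong (scalar-+ _ _ _) (scalar-+ _ _ _)) (scalar-+ _ _ _) ⟩
    ((c₁a₁ ⊕ d₁a₁) ⊕ (c₂a₂ ⊕ d₂a₂)) ⊕ (c₃a₃ ⊕ d₃a₃)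
      ≈⟨ ⊕-cong (interchange _ _ _ _) refl ⟩
    ((c₁a₁ ⊕ c₂a₂) ⊕ (d₁a₁ ⊕ d₂a₂)) ⊕ (c₃a₃ ⊕ d₃a₃)
      ≈⟨ interchange _ _ _ _ ⟩
    lc c a ⊕ lc d a ∎
    where
    c₁a₁ c₂a₂ c₃a₃ d₁a₁ d₂a₂ d₃a₃ : CTerm
    c₁a₁ = const (c ₁) ⊗ a ₁
    c₂a₂ = const (c ₂) ⊗ a ₂
    c₃a₃ = const (c ₃) ⊗ a ₃
    d₁a₁ = const (d ₁) ⊗ a ₁
    d₂a₂ = const (d ₂) ⊗ a ₂
    d₃a₃ = const (d ₃) ⊗ a ₃

  lc-scalar : ∀ (c f : Vec3) a → lc c (λ i → const (f i) ⊗ a) ≈ const (sum3 λ i → c i *ℤ f i) ⊗ a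
  lc-scalar c f a = begin
    lc c (λ i → const (f i) ⊗ a)
      ≈⟨ ⊕-cong (⊕-cong (scalar-* (c ₁) (f ₁) a) (scalar-* (c ₂) (f ₂) a)) (scalar-* (c ₃) (f ₃) a) ⟩
    const (c ₁ *ℤ f ₁) ⊗ a ⊕ const (c ₂ *ℤ f ₂) ⊗ a ⊕ const (c ₃ *ℤ f ₃) ⊗ a
      ≈⟨ ⊕-cong (scalar-+ (c ₁ *ℤ f ₁) (c ₂ *ℤ f ₂) a) refl ⟨
    const (c ₁ *ℤ f ₁ +ℤ c ₂ *ℤ f ₂) ⊗ a ⊕ const (c ₃ *ℤ f ₃) ⊗ a
      ≈⟨ scalar-+ (c ₁ *ℤ f ₁ +ℤ c ₂ *ℤ f ₂) (c ₃ *ℤ f ₃) a ⟨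
    const (sum3 λ i → c i *ℤ f i) ⊗ a ∎

  vec-unit : ∀ i → vec (unit i) ≈ gen i
  vec-unit ₁ = trans (⊕-cong (⊕-cong (⊗-idˡ _) (zeroˡ _)) (zeroˡ _)) (trans (+-identityʳ _) (+-identityʳ _))
  vec-unit ₂ = trans (⊕-cong (⊕-cong (zeroˡ _) (⊗-idˡ _)) (zeroˡ _)) (trans (+-identityʳ _) (+-identityˡ _))
  vec-unit ₃ = trans (⊕-cong (⊕-cong (zeroˡ _) (zeroˡ _)) (⊗-idˡ _)) (trans (⊕-cong (+-identityˡ _) refl) (+-identityˡ _))

  const-cong : ∀ {m n} → m ≡ n → const m ≈ const n
  const-cong ≡.refl = refl

  neg-const : ∀ n → neg (const n) ≈ const (- n)
  neg-const n = trans (sym (const-* _ n)) (const-cong (ℤ.-1*i≡-i n))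

  subtract-left : ∀ {a s b} → a ⊕ s ≈ b → s ≈ b ⊕ neg a
  subtract-left {a} {s} {b} a+s≈b = begin
    s                     ≈⟨ +-identityʳ s ⟨
    s ⊕ 0#                ≈⟨ ⊕-cong refl (-‿inverseʳ a) ⟨
    s ⊕ (a ⊕ neg a)       ≈⟨ ⊕-assoc s a (neg a) ⟨
    (s ⊕ a) ⊕ neg a       ≈⟨ ⊕-cong (trans (⊕-comm s a) a+s≈b) refl ⟩
    b ⊕ neg a             ∎

  vec-anticommute : ∀ x y → vec x ⊗ vec y ⊕ vec y ⊗ vec x ≈ const (polar q x y)
  vec-anticommute x y = trans (subtract-left expand)
    (trans (⊕-cong refl (neg-const _)) (sym (const-+ _ _)))
    where
    u v : CTerm
    u = vec x
    v = vec y
    expand : const (ev q x +ℤ ev q y) ⊕ (u ⊗ v ⊕ v ⊗ u) ≈ const (ev q (x +ᵛ y))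
    expand = begin
      const (ev q x +ℤ ev q y) ⊕ (u ⊗ v ⊕ v ⊗ u)
        ≈⟨ ⊕-cong (trans (const-+ _ _) (sym (⊕-cong (clifford x) (clifford y)))) refl ⟩
      (u ⊗ u ⊕ v ⊗ v) ⊕ (u ⊗ v ⊕ v ⊗ u)   ≈⟨ interchange _ _ _ _ ⟩
      (u ⊗ u ⊕ u ⊗ v) ⊕ (v ⊗ v ⊕ v ⊗ u)   ≈⟨ ⊕-cong (sym (distribˡ u u v)) (trans (⊕-comm _ _) (sym (distribˡ v u v))) ⟩
      u ⊗ (u ⊕ v) ⊕ v ⊗ (u ⊕ v)           ≈⟨ distribʳ (u ⊕ v) u v ⟨
      (u ⊕ v) ⊗ (u ⊕ v)                   ≈⟨ ⊗-cong (lc-+ x y gen) (lc-+ x y gen) ⟨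
      vec (x +ᵛ y) ⊗ vec (x +ᵛ y)         ≈⟨ clifford (x +ᵛ y) ⟩
      const (ev q (x +ᵛ y))               ∎

  gen-square : ∀ i → gen i ⊗ gen i ≈ const (ev q (unit i))
  gen-square i = trans (⊗-cong (sym (vec-unit i)) (sym (vec-unit i))) (clifford (unit i))

  gen-anticommute : ∀ i j → gen i ⊗ gen j ⊕ gen j ⊗ gen i ≈ const (polar q (unit i) (unit j))
  gen-anticommute i j = trans (⊕-cong (⊗-cong eᵢ eⱼ) (⊗-cong eⱼ eᵢ)) (vec-anticommute (unit i) (unit j))
    where
    eᵢ : gen i ≈ vec (unit i)
    eⱼ : gen j ≈ vec (unit j)
    eᵢ = sym (vec-unit i)
    eⱼ = sym (vec-unit j)

  scalar-commutes : ∀ {s k} c → s ≈ const k → s ⊗ c ≈ c ⊗ s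
  scalar-commutes c s≈k =
    trans (⊗-cong s≈k refl) (trans (const-central _ c) (⊗-cong refl (sym s≈k)))

  τ-linear₁ : ∀ b c → Linear (λ a → τ a b c)
  τ-linear₁ b c = +-linear (∘-linear (*ʳ-linear c) (*ʳ-linear b))
                           (∘-linear (*ˡ-linear (neg c)) (∘-linear (*ˡ-linear (neg b)) (*ˡ-linear _)))

  τ-linear₂ : ∀ a c → Linear (λ b → τ a b c)
  τ-linear₂ a c = +-linear (∘-linear (*ʳ-linear c) (*ˡ-linear a))
                           (∘-linear (*ˡ-linear (neg c)) (∘-linear (*ʳ-linear (neg a)) (*ˡ-linear _)))

  τ-linear₃ : ∀ a b → Linear (λ c → τ a b c)
  τ-linear₃ a b = +-linear (*ˡ-linear (a ⊗ b)) (∘-linear (*ʳ-linear (neg b ⊗ neg a)) (*ˡ-linear _))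

  τ≈abc-cba : ∀ a b c → τ a b c ≈ a ⊗ b ⊗ c ⊕ neg (c ⊗ b ⊗ a)
  τ≈abc-cba a b c = ⊕-cong refl (begin
    neg c ⊗ (neg b ⊗ neg a)     ≈⟨ ⊗-cong refl (-‿distribʳ-* (neg b) a) ⟨
    neg c ⊗ neg (neg b ⊗ a)     ≈⟨ ⊗-cong refl (-‿cong (-‿distribˡ-* b a)) ⟨
    neg c ⊗ neg (neg (b ⊗ a))   ≈⟨ ⊗-cong refl (-‿involutive (b ⊗ a)) ⟩
    neg c ⊗ (b ⊗ a)             ≈⟨ -‿distribˡ-* c (b ⊗ a) ⟨
    neg (c ⊗ (b ⊗ a))           ≈⟨ -‿cong (⊗-assoc c b a) ⟨
    neg (c ⊗ b ⊗ a)             ∎)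

  τ-+ : ∀ a b c a' b' c' →
        τ a b c ⊕ τ a' b' c' ≈ (a ⊗ b ⊗ c ⊕ a' ⊗ b' ⊗ c') ⊕ neg (c ⊗ b ⊗ a ⊕ c' ⊗ b' ⊗ a')
  τ-+ a b c a' b' c' = begin
    τ a b c ⊕ τ a' b' c'
      ≈⟨ ⊕-cong (τ≈abc-cba a b c) (τ≈abc-cba a' b' c') ⟩
    (a ⊗ b ⊗ c ⊕ neg (c ⊗ b ⊗ a)) ⊕ (a' ⊗ b' ⊗ c' ⊕ neg (c' ⊗ b' ⊗ a'))
      ≈⟨ interchange _ _ _ _ ⟩
    (a ⊗ b ⊗ c ⊕ a' ⊗ b' ⊗ c') ⊕ (neg (c ⊗ b ⊗ a) ⊕ neg (c' ⊗ b' ⊗ a'))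
      ≈⟨ ⊕-cong refl (-‿+-comm _ _) ⟩
    (a ⊗ b ⊗ c ⊕ a' ⊗ b' ⊗ c') ⊕ neg (c ⊗ b ⊗ a ⊕ c' ⊗ b' ⊗ a') ∎

  τ-palindrome : ∀ {a b c} → a ⊗ b ⊗ c ≈ c ⊗ b ⊗ a → τ a b c ≈ 0#
  τ-palindrome abc≈cba = trans (τ≈abc-cba _ _ _) (x≈y⇒x∙y⁻¹≈ε abc≈cba)

  τ-outer : ∀ a b → τ a b a ≈ 0#
  τ-outer a b = τ-palindrome refl

  τ-square₁₂ : ∀ {a k} c → a ⊗ a ≈ const k → τ a a c ≈ 0#
  τ-square₁₂ {a} c aa≈k = τ-palindrome (trans (scalar-commutes c aa≈k) (sym (⊗-assoc c a a)))

  τ-square₂₃ : ∀ {b k} a → b ⊗ b ≈ const k → τ a b b ≈ 0#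
  τ-square₂₃ {b} a bb≈k = τ-palindrome (trans (⊗-assoc a b b) (sym (scalar-commutes a bb≈k)))

  τ-swap₁₂ : ∀ {a b k} c → a ⊗ b ⊕ b ⊗ a ≈ const k → τ b a c ≈ neg (τ a b c)
  τ-swap₁₂ {a} {b} c ab+ba≈k = +-inverseʳ-unique _ _ (trans (τ-+ a b c b a c) (x≈y⇒x∙y⁻¹≈ε (begin
    a ⊗ b ⊗ c ⊕ b ⊗ a ⊗ c           ≈⟨ distribʳ c _ _ ⟨
    (a ⊗ b ⊕ b ⊗ a) ⊗ c             ≈⟨ scalar-commutes c ab+ba≈k ⟩
    c ⊗ (a ⊗ b ⊕ b ⊗ a)             ≈⟨ distribˡ c _ _ ⟩
    c ⊗ (a ⊗ b) ⊕ c ⊗ (b ⊗ a)       ≈⟨ ⊕-comm _ _ ⟩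
    c ⊗ (b ⊗ a) ⊕ c ⊗ (a ⊗ b)       ≈⟨ ⊕-cong (⊗-assoc c b a) (⊗-assoc c a b) ⟨
    c ⊗ b ⊗ a ⊕ c ⊗ a ⊗ b           ∎)))

  τ-swap₂₃ : ∀ {b c k} a → b ⊗ c ⊕ c ⊗ b ≈ const k → τ a c b ≈ neg (τ a b c)
  τ-swap₂₃ {b} {c} a bc+cb≈k = +-inverseʳ-unique _ _ (trans (τ-+ a b c a c b) (x≈y⇒x∙y⁻¹≈ε (begin
    a ⊗ b ⊗ c ⊕ a ⊗ c ⊗ b           ≈⟨ ⊕-cong (⊗-assoc a b c) (⊗-assoc a c b) ⟩
    a ⊗ (b ⊗ c) ⊕ a ⊗ (c ⊗ b)       ≈⟨ distribˡ a _ _ ⟨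
    a ⊗ (b ⊗ c ⊕ c ⊗ b)             ≈⟨ scalar-commutes a bc+cb≈k ⟨
    (b ⊗ c ⊕ c ⊗ b) ⊗ a             ≈⟨ distribʳ a _ _ ⟩
    b ⊗ c ⊗ a ⊕ c ⊗ b ⊗ a           ≈⟨ ⊕-comm _ _ ⟩
    c ⊗ b ⊗ a ⊕ b ⊗ c ⊗ a           ∎)))

  negated : ∀ {a n t} → a ≈ const n ⊗ t → neg a ≈ const (- n) ⊗ t
  negated {n = n} a≈nt = trans (-‿cong a≈nt) (trans (scalar-* _ n _) (⊗-cong (const-cong (ℤ.-1*i≡-i n)) refl))

  vanishing : ∀ {a t} → a ≈ 0# → a ≈ const (+ 0) ⊗ t
  vanishing {t = t} a≈0 = trans a≈0 (sym (zeroˡ t))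

  τ-gen₁₂₃ : τ (gen ₁) (gen ₂) (gen ₃) ≈ const (+ 1) ⊗ tElt
  τ-gen₁₂₃ = sym (⊗-idˡ tElt)

  τ-gen₂₁₃ : τ (gen ₂) (gen ₁) (gen ₃) ≈ const (- + 1) ⊗ tElt
  τ-gen₂₁₃ = trans (τ-swap₁₂ (gen ₃) (gen-anticommute ₁ ₂)) (negated τ-gen₁₂₃)

  τ-gen₁₃₂ : τ (gen ₁) (gen ₃) (gen ₂) ≈ const (- + 1) ⊗ tElt
  τ-gen₁₃₂ = trans (τ-swap₂₃ (gen ₁) (gen-anticommute ₂ ₃)) (negated τ-gen₁₂₃)

  τ-gen₂₃₁ : τ (gen ₂) (gen ₃) (gen ₁) ≈ const (+ 1) ⊗ tElt
  τ-gen₂₃₁ = trans (τ-swap₂₃ (gen ₂) (gen-anticommute ₁ ₃)) (negated τ-gen₂₁₃)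

  τ-gen₃₁₂ : τ (gen ₃) (gen ₁) (gen ₂) ≈ const (+ 1) ⊗ tElt
  τ-gen₃₁₂ = trans (τ-swap₁₂ (gen ₂) (gen-anticommute ₁ ₃)) (negated τ-gen₁₃₂)

  τ-gen₃₂₁ : τ (gen ₃) (gen ₂) (gen ₁) ≈ const (- + 1) ⊗ tElt
  τ-gen₃₂₁ = trans (τ-swap₂₃ (gen ₃) (gen-anticommute ₁ ₂)) (negated τ-gen₃₁₂)

  τ-gen : ∀ i j k → τ (gen i) (gen j) (gen k) ≈ const (ε i j k) ⊗ tElt
  τ-gen ₁ ₂ ₃ = τ-gen₁₂₃
  τ-gen ₂ ₁ ₃ = τ-gen₂₁₃
  τ-gen ₁ ₃ ₂ = τ-gen₁₃₂
  τ-gen ₂ ₃ ₁ = τ-gen₂₃₁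
  τ-gen ₃ ₁ ₂ = τ-gen₃₁₂
  τ-gen ₃ ₂ ₁ = τ-gen₃₂₁
  τ-gen ₁ ₁ k = vanishing (τ-square₁₂ (gen k) (gen-square ₁))
  τ-gen ₂ ₂ k = vanishing (τ-square₁₂ (gen k) (gen-square ₂))
  τ-gen ₃ ₃ k = vanishing (τ-square₁₂ (gen k) (gen-square ₃))
  τ-gen ₁ ₂ ₂ = vanishing (τ-square₂₃ (gen ₁) (gen-square ₂))
  τ-gen ₁ ₃ ₃ = vanishing (τ-square₂₃ (gen ₁) (gen-square ₃))
  τ-gen ₂ ₁ ₁ = vanishing (τ-square₂₃ (gen ₂) (gen-square ₁))
  τ-gen ₂ ₃ ₃ = vanishing (τ-square₂₃ (gen ₂) (gen-square ₃))
  τ-gen ₃ ₁ ₁ = vanishing (τ-square₂₃ (gen ₃) (gen-square ₁))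
  τ-gen ₃ ₂ ₂ = vanishing (τ-square₂₃ (gen ₃) (gen-square ₂))
  τ-gen ₁ ₂ ₁ = vanishing (τ-outer (gen ₁) (gen ₂))
  τ-gen ₁ ₃ ₁ = vanishing (τ-outer (gen ₁) (gen ₃))
  τ-gen ₂ ₁ ₂ = vanishing (τ-outer (gen ₂) (gen ₁))
  τ-gen ₂ ₃ ₂ = vanishing (τ-outer (gen ₂) (gen ₃))
  τ-gen ₃ ₁ ₃ = vanishing (τ-outer (gen ₃) (gen ₁))
  τ-gen ₃ ₂ ₃ = vanishing (τ-outer (gen ₃) (gen ₂))

  τ-vec : ∀ x y z → τ (vec x) (vec y) (vec z) ≈ const (det-ε x y z) ⊗ tElt
  τ-vec x y z = begin
    τ (vec x) (vec y) (vec z)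
      ≈⟨ linear-lc (τ-linear₁ (vec y) (vec z)) x gen ⟩
    lc x (λ i → τ (gen i) (vec y) (vec z))
      ≈⟨ lc-cong x (λ i → linear-lc (τ-linear₂ (gen i) (vec z)) y gen) ⟩
    lc x (λ i → lc y (λ j → τ (gen i) (gen j) (vec z)))
      ≈⟨ lc-cong x (λ i → lc-cong y (λ j → linear-lc (τ-linear₃ (gen i) (gen j)) z gen)) ⟩
    lc x (λ i → lc y (λ j → lc z (λ k → τ (gen i) (gen j) (gen k))))
      ≈⟨ lc-cong x (λ i → lc-cong y (λ j → lc-cong z (τ-gen i j))) ⟩
    lc x (λ i → lc y (λ j → lc z (λ k → const (ε i j k) ⊗ tElt)))
      ≈⟨ lc-cong x (λ i → lc-cong y (λ j → lc-scalar z (ε i j) tElt)) ⟩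
    lc x (λ i → lc y (λ j → const (sum3 λ k → z k *ℤ ε i j k) ⊗ tElt))
      ≈⟨ lc-cong x (λ i → lc-scalar y (λ j → sum3 λ k → z k *ℤ ε i j k) tElt) ⟩
    lc x (λ i → const (sum3 λ j → y j *ℤ sum3 λ k → z k *ℤ ε i j k) ⊗ tElt)
      ≈⟨ lc-scalar x (λ i → sum3 λ j → y j *ℤ sum3 λ k → z k *ℤ ε i j k) tElt ⟩
    const (det-ε x y z) ⊗ tElt ∎

-- The identity holds for every integral matrix A.
lemma5p1 : (q q'' : Form) → Nonsingular q → Nonsingular q'' → (A : Mat3) → InR q q'' A →
    Cl≈ q (φ A tElt) (const (det3 A) ⊗ tElt)
lemma5p1 q _ _ _ A _ = begin
  φ A tElt
    ≡⟨⟩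
  τ (vec (column A ₁)) (vec (column A ₂)) (vec (column A ₃))
    ≈⟨ τ-vec (column A ₁) (column A ₂) (column A ₃) ⟩
  const (det-ε (column A ₁) (column A ₂) (column A ₃)) ⊗ tElt
    ≡⟨ ≡.cong (λ d → const d ⊗ tElt) (≡.sym (det3≡det-ε A)) ⟩
  const (det3 A) ⊗ tElt ∎
  where
  open CliffordAlgebra q
  open import Relation.Binary.Reasoning.Setoid setoid
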